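{- Let $(X,\tau,\beta,\nu)$ be a computable $T_0$ space. Then (1) any finite intersection of effectively nowhere dense subsets of $X$ is effectively nowhere dense; and (2) the closure of an effectively nowhere dense subset of $X$ is effectively nowhere dense.
   Context: $\Sigma^*$ is the set of finite binary strings. A computable $T_0$ space is a tuple $(X,\tau,\beta,\nu)$ where $(X,\tau)$ is a second countable $T_0$ space, $\beta$ is a countable basis of non-empty open sets, and $\nu:\Sigma^*\dashrightarrow\beta$ is a partial computable surjection such that there is a c.e. set $B\subseteq(\Sigma^*)^3$ with $\nu(u)\cap\nu(v)=\bigcup\{\nu(w):(u,v,w)\in B\}$ for all $u,v\in\mathrm{dom}(\nu)$. A set $A\subseteq X$ is effectively nowhere dense if there exists a computable function $f:\Sigma^*\to\Sigma^*$ such that $\nu(f(w))\subseteq(\nu(w)\setminus A)^{o}$ for all $w\in\mathrm{dom}(\nu)$, where $^{o}$ denotes interior. -}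

module Defs where

open import Data.Nat using (ℕ; zero; suc; _+_; _*_; _<_)
open import Data.Fin using (Fin)
open import Data.Vec using (Vec; []; _∷_; lookup)
open import Data.List using (List; []; _∷_)
open import Data.Bool using (Bool; true; false; if_then_else_)
open import Data.Product using (Σ; ∃; _×_; _,_)
open import Data.Empty using (⊥)
open import Data.Unit using (⊤)
open import Relation.Nullary using (¬_)
open import Relation.Binary.PropositionalEquality using (_≡_)
open import Level using (Level; _⊔_) renaming (suc to lsuc)
import Level

Σ* : Set
Σ* = List Bool

enc : Σ* → ℕ
enc []      = 0
enc (b ∷ w) = suc (2 * enc w + (if b then 1 else 0))

data PR : ℕ → Set where
  Z : ∀ {n} → PR n
  S : PR 1
  P : ∀ {n} → Fin n → PR n
  C : ∀ {m n} → PR m → Vec (PR n) m → PR n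
  R : ∀ {n} → PR n → PR (suc (suc n)) → PR (suc n)
  M : ∀ {n} → PR (suc n) → PR n

mutual
  data _[_]⇓_ : ∀ {n} → PR n → Vec ℕ n → ℕ → Set where
    evZ : ∀ {n} {xs : Vec ℕ n} → Z [ xs ]⇓ 0
    evS : ∀ {x} → S [ x ∷ [] ]⇓ suc x
    evP : ∀ {n} {i : Fin n} {xs} → P i [ xs ]⇓ lookup xs i
    evC : ∀ {m n} {f : PR m} {gs : Vec (PR n) m} {xs ys y} →
          gs [ xs ]⇓* ys → f [ ys ]⇓ y → C f gs [ xs ]⇓ y
    evR0 : ∀ {n} {f : PR n} {g} {xs y} →
           f [ xs ]⇓ y → R f g [ 0 ∷ xs ]⇓ y
    evRS : ∀ {n} {f : PR n} {g} {k xs r y} →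
           R f g [ k ∷ xs ]⇓ r → g [ k ∷ r ∷ xs ]⇓ y → R f g [ suc k ∷ xs ]⇓ y
    evM : ∀ {n} {f : PR (suc n)} {xs k} →
          f [ k ∷ xs ]⇓ 0 →
          (∀ m → m < k → Σ ℕ λ j → f [ m ∷ xs ]⇓ suc j) →
          M f [ xs ]⇓ k

  data _[_]⇓*_ : ∀ {m n} → Vec (PR n) m → Vec ℕ n → Vec ℕ m → Set where
    ev[] : ∀ {n} {xs : Vec ℕ n} → [] [ xs ]⇓* []
    ev∷  : ∀ {m n} {g : PR n} {gs : Vec (PR n) m} {xs y ys} →
           g [ xs ]⇓ y → gs [ xs ]⇓* ys → (g ∷ gs) [ xs ]⇓* (y ∷ ys)

Computable : (Σ* → Σ*) → Set
Computable f = Σ (PR 1) λ c → ∀ w → c [ enc w ∷ [] ]⇓ enc (f w)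

CE : (Σ* → Set) → Set
CE D = Σ (PR 1) λ c → ∀ w → (D w → ∃ λ n → c [ enc w ∷ [] ]⇓ n)
                           × ((∃ λ n → c [ enc w ∷ [] ]⇓ n) → D w)

CE₃ : (Σ* → Σ* → Σ* → Set) → Set
CE₃ B = Σ (PR 3) λ c → ∀ u v w →
          (B u v w → ∃ λ n → c [ enc u ∷ enc v ∷ enc w ∷ [] ]⇓ n)
        × ((∃ λ n → c [ enc u ∷ enc v ∷ enc w ∷ [] ]⇓ n) → B u v w)

Subset : Set → Set₁
Subset X = X → Set

-- predicates of arbitrary level (interior/closure quantify over open sets
-- and hence land in Set₁)
Pred : Set → (ℓ : Level) → Set (lsuc ℓ)
Pred X ℓ = X → Set ℓ

_⊆_ : {X : Set} {a b : Level} → Pred X a → Pred X b → Set (a ⊔ b)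
A ⊆ B = ∀ x → A x → B x

_∖_ : {X : Set} {a b : Level} → Pred X a → Pred X b → Pred X (a ⊔ b)
(A ∖ B) x = A x × ¬ B x

record IsTopology {X : Set} (τ : Subset X → Set) : Set₁ where
  field
    univ-open  : τ (λ _ → ⊤)
    union-open : (I : Set) (U : I → Subset X) → (∀ i → τ (U i)) →
                 τ (λ x → Σ I λ i → U i x)
    inter-open : ∀ U V → τ U → τ V → τ (λ x → U x × V x)

interior : {X : Set} {ℓ : Level} → (Subset X → Set) → Pred X ℓ → Pred X (lsuc Level.zero ⊔ ℓ)
interior τ A x = Σ _ λ U → τ U × U x × (U ⊆ A)

closure : {X : Set} {ℓ : Level} → (Subset X → Set) → Pred X ℓ → Pred X (lsuc Level.zero ⊔ ℓ)
closure τ A x = ∀ U → τ U → U x → Σ _ λ y → U y × A y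

IsT0 : {X : Set} → (Subset X → Set) → Set₁
IsT0 {X} τ = ∀ x y → (∀ U → τ U → (U x → U y) × (U y → U x)) → x ≡ y

-- Computable T₀ spaces (X, τ, β, ν).  The partial map ν : Σ* ⇀ β is
-- given by its domain `dom` and a map ν defined on all strings whose
-- values outside `dom` are irrelevant.

record ComputableT0Space (X : Set) : Set₂ where
  field
    τ       : Subset X → Set
    isTop   : IsTopology τ
    t0      : IsT0 τ
    β       : Subset X → Set
    β-open  : ∀ U → β U → τ U
    β-nonempty : ∀ U → β U → Σ X λ x → U x
    β-basis : ∀ U → τ U → ∀ x → U x → Σ _ λ B → β B × B x × (B ⊆ U)
    dom     : Σ* → Set
    dom-ce  : CE dom
    ν       : Σ* → Subset X
    ν-into  : ∀ w → dom w → β (ν w)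
    ν-onto  : ∀ B → β B → Σ Σ* λ w → dom w × (∀ x → (B x → ν w x) × (ν w x → B x))
    Bint    : Σ* → Σ* → Σ* → Set
    Bint-ce : CE₃ Bint
    ν-inter : ∀ u v → dom u → dom v → ∀ x →
              ((ν u x × ν v x) → Σ Σ* λ w → Bint u v w × dom w × ν w x)
            × ((Σ Σ* λ w → Bint u v w × dom w × ν w x) → ν u x × ν v x)

module _ {X : Set} (𝕏 : ComputableT0Space X) where
  open ComputableT0Space 𝕏

  EffNowhereDense : {ℓ : Level} → Pred X ℓ → Set (lsuc Level.zero ⊔ ℓ)
  EffNowhereDense A = Σ (Σ* → Σ*) λ f → Computable f ×
    (∀ w → dom w → dom (f w) × (ν (f w) ⊆ interior τ (ν w ∖ A)))

⋂ : {X : Set} {ℓ : Level} {n : ℕ} → (Fin n → Pred X ℓ) → Pred X ℓ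
⋂ {n = n} A x = ∀ (i : Fin n) → A i x

-- Effective nowhere density only depends on the interiors of the sets ν w ∖ A,
-- so it transfers to any B for which these interiors can only grow.  This holds
-- for B ⊆ A, in particular for ⋂ A ⊆ A zero, and for B = closure A, because an
-- open set disjoint from A is disjoint from its closure.
module Submission where

open import Defs
open import Data.Nat using (ℕ; suc)
open import Data.Fin using (Fin; zero)
open import Data.Product using (_×_; _,_; proj₁; proj₂)
open import Function using (_∘_)
open import Level using (Level)

module _ {X : Set} where

  ⋂⊆ : ∀ {ℓ n} (A : Fin n → Pred X ℓ) (i : Fin n) → ⋂ A ⊆ A i
  ⋂⊆ A i x ⋂Ax = ⋂Ax i

  interior-mono : ∀ {a b} (τ : Subset X → Set) {A : Pred X a} {B : Pred X b} →
                  A ⊆ B → interior τ A ⊆ interior τ B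
  interior-mono τ A⊆B x (U , τU , Ux , U⊆A) = U , τU , Ux , λ y → A⊆B y ∘ U⊆A y

  ∖-antitoneʳ : ∀ {a b c} (V : Pred X a) {A : Pred X b} {B : Pred X c} →
                B ⊆ A → (V ∖ A) ⊆ (V ∖ B)
  ∖-antitoneʳ V B⊆A x (Vx , ¬Ax) = Vx , ¬Ax ∘ B⊆A x

  interior-∖-closure : ∀ {a b} (τ : Subset X → Set) (V : Pred X a) (A : Pred X b) →
                       interior τ (V ∖ A) ⊆ interior τ (V ∖ closure τ A)
  interior-∖-closure τ V A x (U , τU , Ux , U⊆V∖A) =
    U , τU , Ux , λ y Uy → proj₁ (U⊆V∖A y Uy) , λ clAy →
      let (z , Uz , Az) = clAy U τU Uy in proj₂ (U⊆V∖A z Uz) Az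

module _ {X : Set} (𝕏 : ComputableT0Space X) where
  open ComputableT0Space 𝕏

  EffNowhereDense-transfer : ∀ {a b} {A : Pred X a} {B : Pred X b} →
    (∀ (V : Subset X) → interior τ (V ∖ A) ⊆ interior τ (V ∖ B)) →
    EffNowhereDense 𝕏 A → EffNowhereDense 𝕏 B
  EffNowhereDense-transfer grow (f , f-computable , f-sound) =
    f , f-computable , λ w dw →
      proj₁ (f-sound w dw) , λ x → grow (ν w) x ∘ proj₂ (f-sound w dw) x

  EffNowhereDense-anti : ∀ {a b} {A : Pred X a} {B : Pred X b} →
    B ⊆ A → EffNowhereDense 𝕏 A → EffNowhereDense 𝕏 B
  EffNowhereDense-anti B⊆A =
    EffNowhereDense-transfer λ V → interior-mono τ (∖-antitoneʳ V B⊆A)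

  EffNowhereDense-closure : ∀ {ℓ} {A : Pred X ℓ} →
    EffNowhereDense 𝕏 A → EffNowhereDense 𝕏 (closure τ A)
  EffNowhereDense-closure {A = A} =
    EffNowhereDense-transfer λ V → interior-∖-closure τ V A

mainTheorem5 : {X : Set} {ℓ : Level} (𝕏 : ComputableT0Space X) →
    ((n : ℕ) (A : Fin (suc n) → Pred X ℓ) →
    (∀ i → EffNowhereDense 𝕏 (A i)) → EffNowhereDense 𝕏 (⋂ A))
    × ((A : Pred X ℓ) → EffNowhereDense 𝕏 A →
    EffNowhereDense 𝕏 (closure (ComputableT0Space.τ 𝕏) A))
mainTheorem5 𝕏 =
  (λ n A A-end → EffNowhereDense-anti 𝕏 (⋂⊆ A zero) (A-end zero)) ,
  (λ A → EffNowhereDense-closure 𝕏)
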